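{- Let $T$ be a tree with $n$ vertices that is isomorphic to $S^{0}(K_{1,\frac{n-1}{2}})$ or $S^{2}(K_{1,\frac{n+1}{2}})$ when $n$ is odd, or to $S^{1}(K_{1,\frac{n}{2}})$ when $n$ is even. Then $\Psi(T)=\lceil\frac{n}{2}\rceil$.
   Context: All graphs are finite and simple. A matching of a graph is a set of edges no two of which share a vertex; it is maximal if it is not properly contained in another matching (the empty matching is maximal in an edgeless graph). $\Psi(G)$ denotes the number of maximal matchings of $G$. For integers $0\le t\le m$, $S^{t}(K_{1,m})$ denotes the tree with $2m-t+1$ vertices obtained from the star $K_{1,m}$ by subdividing exactly $m-t$ of its edges, each once. -}

module Defs where

open import Data.Nat using (ℕ; zero; suc; _+_; _*_; _∸_; _≤_; _≡ᵇ_; _≤ᵇ_)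
open import Data.Bool using (Bool; true; false; _∧_; _∨_; not; if_then_else_)
open import Data.Fin using (Fin; toℕ; _≟_)
open import Data.List using (List; []; _∷_; concatMap; map; filterᵇ; length)
open import Data.Bool.ListAction using (and)
open import Data.List using () renaming (allFin to allFinL)
open import Data.Vec using (Vec; []; _∷_; lookup; updateAt)
open import Relation.Binary.PropositionalEquality using (_≡_; refl; cong; cong₂)
open import Function.Bundles using (Inverse)
open import Function.Bundles using (_↔_)

record Graph (n : ℕ) : Set where
  field
    adj    : Fin n → Fin n → Bool
    sym    : ∀ i j → adj i j ≡ adj j i
    irrefl : ∀ i → adj i i ≡ false
open Graph public

record _≅_ {n m : ℕ} (G : Graph n) (H : Graph m) : Set where
  field
    bij      : Fin n ↔ Fin m
    preserve : ∀ i j → adj G i j ≡ adj H (Inverse.to bij i) (Inverse.to bij j)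

-- Edge sets of a graph on Fin n are encoded as symmetric Boolean
-- matrices (M i j = true iff {i,j} is in the set).

Mat : ℕ → Set
Mat n = Vec (Vec Bool n) n

entry : ∀ {n} → Mat n → Fin n → Fin n → Bool
entry M i j = lookup (lookup M i) j

addEdge : ∀ {n} → Mat n → Fin n → Fin n → Mat n
addEdge M i j = updateAt (updateAt M i (λ r → updateAt r j (λ _ → true))) j
                         (λ r → updateAt r i (λ _ → true))

forallV : ∀ {n} → (Fin n → Bool) → Bool
forallV p = and (map p (allFinL _))

_⇒ᵇ_ : Bool → Bool → Bool
a ⇒ᵇ b = not a ∨ b

countB : ∀ {n} → (Fin n → Bool) → ℕ
countB {n} p = length (filterᵇ p (allFinL n))

isMatching : ∀ {n} → Graph n → Mat n → Bool
isMatching G M =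
  forallV (λ i → forallV (λ j →
      (entry M i j ⇒ᵇ adj G i j) ∧ (entry M i j ⇒ᵇ entry M j i)))
  ∧ forallV (λ i → countB (entry M i) ≤ᵇ 1)

-- M is a maximal matching: a matching not properly contained in another
-- matching, i.e. no edge of G outside M can be added keeping a matching.
-- (Any matching properly containing M contains M plus one further edge,
--  which is again a matching.)
isMaximalMatching : ∀ {n} → Graph n → Mat n → Bool
isMaximalMatching G M =
  isMatching G M ∧
  forallV (λ i → forallV (λ j →
     (adj G i j ∧ not (entry M i j)) ⇒ᵇ not (isMatching G (addEdge M i j))))

vecsOf : ∀ {A : Set} → List A → (k : ℕ) → List (Vec A k)
vecsOf xs zero    = [] ∷ []
vecsOf xs (suc k) = concatMap (λ x → map (x ∷_) (vecsOf xs k)) xs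

allMats : (n : ℕ) → List (Mat n)
allMats n = vecsOf (vecsOf (true ∷ false ∷ []) n) n

Ψ : ∀ {n} → Graph n → ℕ
Ψ {n} G = length (filterᵇ (isMaximalMatching G) (allMats n))

-- S^t(K_{1,m}) on vertex set Fin (2m - t + 1):
-- vertex 0 is the centre, vertices 1..m are the neighbours of the centre,
-- and for 1 ≤ i ≤ m - t the edge {0,i} is subdivided, giving the path
-- 0 - i - (m+i).  (Intended for t ≤ m.)

starArc : ℕ → ℕ → ℕ → ℕ → Bool
starArc m t a b =
     ((a ≡ᵇ 0) ∧ (1 ≤ᵇ b) ∧ (b ≤ᵇ m))
  ∨ ((1 ≤ᵇ a) ∧ (a ≤ᵇ m ∸ t) ∧ (b ≡ᵇ m + a))

-- adjacency (the guard a ≠ b is redundant, it only eases irreflexivity)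
starAdjℕ : ℕ → ℕ → ℕ → ℕ → Bool
starAdjℕ m t a b = not (a ≡ᵇ b) ∧ (starArc m t a b ∨ starArc m t b a)

private
  ∨-comm : ∀ a b → (a ∨ b) ≡ (b ∨ a)
  ∨-comm false false = refl
  ∨-comm false true  = refl
  ∨-comm true  false = refl
  ∨-comm true  true  = refl

  ≡ᵇ-sym : ∀ a b → (a ≡ᵇ b) ≡ (b ≡ᵇ a)
  ≡ᵇ-sym zero zero = refl
  ≡ᵇ-sym zero (suc b) = refl
  ≡ᵇ-sym (suc a) zero = refl
  ≡ᵇ-sym (suc a) (suc b) = ≡ᵇ-sym a b

  ≡ᵇ-refl : ∀ a → (a ≡ᵇ a) ≡ true
  ≡ᵇ-refl zero = refl
  ≡ᵇ-refl (suc a) = ≡ᵇ-refl a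

S : (t m : ℕ) → Graph (2 * m ∸ t + 1)
S t m = record
  { adj    = λ i j → starAdjℕ m t (toℕ i) (toℕ j)
  ; sym    = λ i j → cong₂ _∧_ (cong not (≡ᵇ-sym (toℕ i) (toℕ j)))
                       (∨-comm (starArc m t (toℕ i) (toℕ j)) (starArc m t (toℕ j) (toℕ i)))
  ; irrefl = λ i → cong (λ x → not x ∧ (starArc m t (toℕ i) (toℕ i) ∨ starArc m t (toℕ i) (toℕ i))) (≡ᵇ-refl (toℕ i))
  }

module Submission where

-- A maximal matching of S^t(K_{1,m}) is determined by the centre. If the centre is matched to a
-- neighbour j, maximality forces every other subdivided neighbour i to be matched to its pendant
-- vertex m + i; if the centre is unmatched, every neighbour of it must be matched to a pendant
-- vertex, which is possible only when t = 0. Hence Ψ(S^t(K_{1,m})) = m + [t = 0], and this is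
-- ⌈n/2⌉ in each of the three cases; Ψ is invariant under isomorphism.

open import Defs hiding (sym)
open import Data.Bool using (Bool; true; false; T; not; _∧_; _∨_; if_then_else_)
open import Data.Bool.Properties using (T-∧; T-∨)
open import Data.Bool.ListAction using (and)
open import Data.Empty using (⊥; ⊥-elim)
open import Data.Fin using (Fin; _≟_; toℕ; fromℕ<)
import Data.Fin as Fin
open import Data.Fin.Properties using (any?; suc-injective; toℕ-injective; toℕ-fromℕ<; toℕ≤pred[n])
open import Data.List using (List; []; _∷_; map; length; filterᵇ; allFin; concatMap)
open import Data.List.Properties using (length-map; length-tabulate)
open import Data.List.Membership.Propositional using (_∈_)
open import Data.List.Membership.Propositional.Properties
  using (∈-allFin; ∈-filter⁺; ∈-filter⁻; ∈-map⁺; ∈-map⁻; ∈-++⁻; ∈-concatMap⁺)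
open import Data.List.Relation.Unary.All using (All; []; _∷_)
import Data.List.Relation.Unary.All as All
open import Data.List.Relation.Unary.Any using (here; there)
import Data.List.Relation.Unary.Any as Any
open import Data.List.Relation.Unary.Unique.Propositional using (Unique; []; _∷_)
import Data.List.Relation.Unary.Unique.Propositional.Properties as Unique
open import Data.Nat
  using (ℕ; zero; suc; _+_; _*_; _∸_; _≤_; _≰_; _<_; _≤ᵇ_; _≡ᵇ_; z≤n; s≤s; z<s; ⌊_/2⌋; ⌈_/2⌉)
  renaming (_≟_ to _≟ℕ_)
open import Data.Nat.Properties
  using ( ≤ᵇ⇒≤; ≤⇒≤ᵇ; ≡ᵇ⇒≡; ≡⇒≡ᵇ; ≤-refl; ≤-trans; ≤-antisym; ≤-<-trans; <⇒≱; n≢0⇒n>0; n>0⇒n≢0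
        ; m<m+n; m≤m+n; +-monoʳ-≤; +-cancelˡ-≡; +-comm; +-identityʳ; +-∸-assoc; m∸n≤m; m∸[m∸n]≡n
        ; n∸n≡0; n≡⌊n+n/2⌋; n≡⌈n+n/2⌉)
open import Data.Product using (Σ; _×_; _,_; proj₁; proj₂; ∃)
open import Data.Sum using (_⊎_; inj₁; inj₂)
import Data.Sum
open import Data.Unit using (tt)
open import Data.Vec using (Vec; []; _∷_; lookup; updateAt)
import Data.Vec as Vec
import Data.Vec.Properties as Vecₚ
open import Function using (id; _∘_; case_of_)
open import Function.Bundles using (Equivalence; Inverse; _⇔_; mk⇔)
open import Function.Properties.Inverse using (↔-sym)
open import Relation.Binary.Construct.Closure.Symmetric using (SymClosure; fwd; bwd)
import Relation.Binary.Construct.Closure.Symmetric as Sym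
open import Relation.Binary.PropositionalEquality
  using (_≡_; _≢_; refl; sym; trans; cong; cong₂; subst; module ≡-Reasoning)
open import Relation.Nullary using (¬_; Dec; yes; no; does)
open import Relation.Nullary.Decidable using (T?)

open Equivalence using (to; from)

module _ {A : Set} where

  private
    remove : ∀ {x : A} ys → x ∈ ys → List A
    remove (y ∷ ys) (here _)  = ys
    remove (y ∷ ys) (there p) = y ∷ remove ys p

    length-remove : ∀ {x : A} ys (p : x ∈ ys) → suc (length (remove ys p)) ≡ length ys
    length-remove (y ∷ ys) (here _)  = refl
    length-remove (y ∷ ys) (there p) = cong suc (length-remove ys p)

    ∈-remove : ∀ {x z : A} ys (p : x ∈ ys) → z ∈ ys → z ≢ x → z ∈ remove ys p
    ∈-remove (y ∷ ys) (here refl) (here refl) z≢x = ⊥-elim (z≢x refl)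
    ∈-remove (y ∷ ys) (here refl) (there q)   _   = q
    ∈-remove (y ∷ ys) (there p)   (here refl) _   = here refl
    ∈-remove (y ∷ ys) (there p)   (there q)   z≢x = there (∈-remove ys p q z≢x)

  Unique⇒length≤ : ∀ {xs ys : List A} → Unique xs → (∀ {z} → z ∈ xs → z ∈ ys) →
                   length xs ≤ length ys
  Unique⇒length≤ {[]}     _          _     = z≤n
  Unique⇒length≤ {x ∷ xs} {ys} (x∉ ∷ u) xs⊆ys =
    subst (suc (length xs) ≤_) (length-remove ys x∈ys)
      (s≤s (Unique⇒length≤ u λ z∈xs →
        ∈-remove ys x∈ys (xs⊆ys (there z∈xs)) λ z≡x → All.lookup x∉ z∈xs (sym z≡x)))
    where
    x∈ys : x ∈ ys
    x∈ys = xs⊆ys (here refl)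

  length≤1 : ∀ {xs : List A} → Unique xs → (∀ {x y} → x ∈ xs → y ∈ xs → x ≡ y) → length xs ≤ 1
  length≤1 {[]}     _ _    = z≤n
  length≤1 {x ∷ xs} u all≡ = Unique⇒length≤ {ys = x ∷ []} u λ y∈ → here (all≡ y∈ (here refl))

  1<length : ∀ {xs : List A} {x y} → x ≢ y → x ∈ xs → y ∈ xs → 1 < length xs
  1<length x≢y x∈ y∈ = Unique⇒length≤ ((x≢y ∷ []) ∷ [] ∷ [])
    λ { (here refl) → x∈ ; (there (here refl)) → y∈ }

T-⇒ᵇ⁻ : ∀ {a b} → T (a ⇒ᵇ b) → T a → T b
T-⇒ᵇ⁻ {true} b _ = b

T-⇒ᵇ⁺ : ∀ {a b} → (T a → T b) → T (a ⇒ᵇ b)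
T-⇒ᵇ⁺ {true}  f = f tt
T-⇒ᵇ⁺ {false} _ = tt

T-not⁻ : ∀ {b} → T (not b) → ¬ T b
T-not⁻ {false} _ ()

T-not⁺ : ∀ {b} → ¬ T b → T (not b)
T-not⁺ {true}  ¬b = ¬b tt
T-not⁺ {false} _  = tt

T-∧³ : ∀ {x y z} → T (x ∧ y ∧ z) → T x × T y × T z
T-∧³ h = let (hx , hyz) = to T-∧ h in hx , to T-∧ hyz

T-ext : ∀ {x y} → (T x → T y) → (T y → T x) → x ≡ y
T-ext {false} {false} _ _ = refl
T-ext {false} {true}  _ f = ⊥-elim (f tt)
T-ext {true}  {false} f _ = ⊥-elim (f tt)
T-ext {true}  {true}  _ _ = refl

T-and-map⁻ : ∀ {A : Set} (p : A → Bool) xs → T (and (map p xs)) → All (T ∘ p) xs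
T-and-map⁻ p []       _ = []
T-and-map⁻ p (x ∷ xs) h = proj₁ (to T-∧ h) ∷ T-and-map⁻ p xs (proj₂ (to T-∧ h))

T-and-map⁺ : ∀ {A : Set} (p : A → Bool) {xs} → All (T ∘ p) xs → T (and (map p xs))
T-and-map⁺ p []       = tt
T-and-map⁺ p (h ∷ hs) = from T-∧ (h , T-and-map⁺ p hs)

T-forallV⁻ : ∀ {n} {p : Fin n → Bool} → T (forallV p) → ∀ i → T (p i)
T-forallV⁻ {n} {p} h i = All.lookup (T-and-map⁻ p (allFin n) h) (∈-allFin i)

T-forallV⁺ : ∀ {n} {p : Fin n → Bool} → (∀ i → T (p i)) → T (forallV p)
T-forallV⁺ {n} {p} h = T-and-map⁺ p {allFin n} (All.tabulate λ {i} _ → h i)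

AtMostOne : ∀ {n} → (Fin n → Bool) → Set
AtMostOne p = ∀ {i j} → T (p i) → T (p j) → i ≡ j

module _ {n} (p : Fin n → Bool) where

  private
    ∈-filter-allFin⁺ : ∀ {i} → T (p i) → i ∈ filterᵇ p (allFin n)
    ∈-filter-allFin⁺ = ∈-filter⁺ (T? ∘ p) (∈-allFin _)

    ∈-filter-allFin⁻ : ∀ {i} → i ∈ filterᵇ p (allFin n) → T (p i)
    ∈-filter-allFin⁻ = proj₂ ∘ ∈-filter⁻ (T? ∘ p) {xs = allFin n}

  T-countB≤1⁻ : T (countB p ≤ᵇ 1) → AtMostOne p
  T-countB≤1⁻ h {i} {j} pi pj with i ≟ j
  ... | yes i≡j = i≡j
  ... | no  i≢j =
    ⊥-elim (<⇒≱ (1<length i≢j (∈-filter-allFin⁺ pi) (∈-filter-allFin⁺ pj)) (≤ᵇ⇒≤ _ 1 h))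

  T-countB≤1⁺ : AtMostOne p → T (countB p ≤ᵇ 1)
  T-countB≤1⁺ atMostOne = ≤⇒≤ᵇ (length≤1 (Unique.filter⁺ (T? ∘ p) (Unique.allFin⁺ n))
    λ i∈ j∈ → atMostOne (∈-filter-allFin⁻ i∈) (∈-filter-allFin⁻ j∈))

-- Matchings

record IsMatching {n} (G : Graph n) (E : Fin n → Fin n → Bool) : Set where
  field
    ⊆adj       : ∀ {i j} → T (E i j) → T (adj G i j)
    symmetric  : ∀ {i j} → T (E i j) → T (E j i)
    functional : ∀ {i j k} → T (E i j) → T (E i k) → j ≡ k

Covered : ∀ {n} → (Fin n → Fin n → Bool) → Fin n → Set
Covered E i = ∃ λ k → T (E i k)

covered? : ∀ {n} (E : Fin n → Fin n → Bool) i → Dec (Covered E i)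
covered? E i = any? λ k → T? (E i k)

record IsMaximalMatching {n} (G : Graph n) (E : Fin n → Fin n → Bool) : Set where
  field
    matching : IsMatching G E
    cover    : ∀ {i j} → T (adj G i j) → Covered E i ⊎ Covered E j
  open IsMatching matching public

T-isMatching⁻ : ∀ {n} {G : Graph n} {M} → T (isMatching G M) → IsMatching G (entry M)
T-isMatching⁻ {G = G} {M} h = record
  { ⊆adj       = λ {i} {j} → T-⇒ᵇ⁻ (proj₁ (edgeClauses i j))
  ; symmetric  = λ {i} {j} → T-⇒ᵇ⁻ (proj₂ (edgeClauses i j))
  ; functional = λ {i} → T-countB≤1⁻ _ (T-forallV⁻ (proj₂ (to T-∧ h)) i)
  }
  where
  edgeClauses : ∀ i j → T (entry M i j ⇒ᵇ adj G i j) × T (entry M i j ⇒ᵇ entry M j i)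
  edgeClauses i j = to T-∧ (T-forallV⁻ (T-forallV⁻ (proj₁ (to T-∧ h)) i) j)

T-isMatching⁺ : ∀ {n} {G : Graph n} {M} → IsMatching G (entry M) → T (isMatching G M)
T-isMatching⁺ {M = M} m = from T-∧
  ( T-forallV⁺ (λ i → T-forallV⁺ λ j → from T-∧ (T-⇒ᵇ⁺ (⊆adj {i} {j}) , T-⇒ᵇ⁺ (symmetric {i} {j})))
  , T-forallV⁺ {p = λ i → countB (entry M i) ≤ᵇ 1} (λ i → T-countB≤1⁺ (entry M i) functional))
  where open IsMatching m

private
  lookup-setTrue : ∀ {n} (r : Vec Bool n) k b →
                   lookup (updateAt r k (λ _ → true)) b ≡ does (b ≟ k) ∨ lookup r b
  lookup-setTrue r k b with b ≟ k
  ... | yes refl = Vecₚ.lookup∘updateAt b r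
  ... | no  b≢k  = Vecₚ.lookup∘updateAt′ b k b≢k r

  entry-setTrue : ∀ {n} (M : Mat n) k l a b →
                  entry (updateAt M k (λ r → updateAt r l (λ _ → true))) a b
                    ≡ (does (a ≟ k) ∧ does (b ≟ l)) ∨ entry M a b
  entry-setTrue M k l a b with a ≟ k
  ... | yes refl = trans (cong (λ r → lookup r b) (Vecₚ.lookup∘updateAt a M))
                         (lookup-setTrue (lookup M a) l b)
  ... | no  a≢k  = cong (λ r → lookup r b) (Vecₚ.lookup∘updateAt′ a k a≢k M)

  T-pairOr⁻ : ∀ {n} {a b k l : Fin n} {x} → T ((does (a ≟ k) ∧ does (b ≟ l)) ∨ x) →
              (a ≡ k × b ≡ l) ⊎ T x
  T-pairOr⁻ {a = a} {b} {k} {l} h with a ≟ k | b ≟ l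
  ... | yes a≡k | yes b≡l = inj₁ (a≡k , b≡l)
  ... | yes _   | no _    = inj₂ h
  ... | no _    | _       = inj₂ h

entry-addEdge : ∀ {n} (M : Mat n) i j a b → entry (addEdge M i j) a b
              ≡ (does (a ≟ j) ∧ does (b ≟ i)) ∨ ((does (a ≟ i) ∧ does (b ≟ j)) ∨ entry M a b)
entry-addEdge M i j a b =
  trans (entry-setTrue (updateAt M i (λ r → updateAt r j (λ _ → true))) j i a b)
        (cong (does (a ≟ j) ∧ does (b ≟ i) ∨_) (entry-setTrue M i j a b))

module _ {n} (M : Mat n) (i j : Fin n) where

  T-entry-addEdge⁻ : ∀ {a b} → T (entry (addEdge M i j) a b) →
                     (a ≡ j × b ≡ i) ⊎ (a ≡ i × b ≡ j) ⊎ T (entry M a b)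
  T-entry-addEdge⁻ {a} {b} h rewrite entry-addEdge M i j a b with T-pairOr⁻ {a = a} {b} {j} {i} h
  ... | inj₁ ji = inj₁ ji
  ... | inj₂ h′ = inj₂ (T-pairOr⁻ {a = a} {b} {i} {j} h′)

  T-entry-addEdge-⊇ : ∀ {a b} → T (entry M a b) → T (entry (addEdge M i j) a b)
  T-entry-addEdge-⊇ {a} {b} e rewrite entry-addEdge M i j a b
    with does (a ≟ j) ∧ does (b ≟ i) | does (a ≟ i) ∧ does (b ≟ j)
  ... | true  | _     = tt
  ... | false | true  = tt
  ... | false | false = e

  T-entry-addEdge-ij : T (entry (addEdge M i j) i j)
  T-entry-addEdge-ij rewrite entry-addEdge M i j i j
    with i ≟ i | j ≟ j | does (i ≟ j) ∧ does (j ≟ i)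
  ... | yes _  | yes _  | true  = tt
  ... | yes _  | yes _  | false = tt
  ... | no i≢i | _      | _     = ⊥-elim (i≢i refl)
  ... | _      | no j≢j | _     = ⊥-elim (j≢j refl)

  T-entry-addEdge-ji : T (entry (addEdge M i j) j i)
  T-entry-addEdge-ji rewrite entry-addEdge M i j j i with j ≟ j | i ≟ i
  ... | yes _  | yes _  = tt
  ... | no j≢j | _      = ⊥-elim (j≢j refl)
  ... | _      | no i≢i = ⊥-elim (i≢i refl)

module _ {n} {G : Graph n} {M : Mat n} {i j : Fin n} (m : IsMatching G (entry M)) where
  open IsMatching m

  addEdge-isMatching : T (adj G i j) → ¬ Covered (entry M) i → ¬ Covered (entry M) j →
                       IsMatching G (entry (addEdge M i j))
  addEdge-isMatching ij ¬cov-i ¬cov-j = record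
    { ⊆adj       = λ e → ⊆adj′ (T-entry-addEdge⁻ M i j e)
    ; symmetric  = λ e → symmetric′ (T-entry-addEdge⁻ M i j e)
    ; functional = λ e e′ → functional′ (T-entry-addEdge⁻ M i j e) (T-entry-addEdge⁻ M i j e′)
    }
    where
    ⊆adj′ : ∀ {a b} → (a ≡ j × b ≡ i) ⊎ (a ≡ i × b ≡ j) ⊎ T (entry M a b) → T (adj G a b)
    ⊆adj′ (inj₁ (refl , refl))        = subst T (Graph.sym G i j) ij
    ⊆adj′ (inj₂ (inj₁ (refl , refl))) = ij
    ⊆adj′ (inj₂ (inj₂ e))             = ⊆adj e

    symmetric′ : ∀ {a b} → (a ≡ j × b ≡ i) ⊎ (a ≡ i × b ≡ j) ⊎ T (entry M a b) →
                 T (entry (addEdge M i j) b a)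
    symmetric′ (inj₁ (refl , refl))        = T-entry-addEdge-ij M i j
    symmetric′ (inj₂ (inj₁ (refl , refl))) = T-entry-addEdge-ji M i j
    symmetric′ (inj₂ (inj₂ e))             = T-entry-addEdge-⊇ M i j (symmetric e)

    functional′ : ∀ {a b c} → (a ≡ j × b ≡ i) ⊎ (a ≡ i × b ≡ j) ⊎ T (entry M a b) →
                  (a ≡ j × c ≡ i) ⊎ (a ≡ i × c ≡ j) ⊎ T (entry M a c) → b ≡ c
    functional′ (inj₁ (refl , refl))        (inj₁ (_ , refl))          = refl
    functional′ (inj₁ (refl , refl))        (inj₂ (inj₁ (j≡i , refl))) = sym j≡i
    functional′ (inj₂ (inj₁ (refl , refl))) (inj₁ (i≡j , refl))        = sym i≡j
    functional′ (inj₂ (inj₁ (refl , refl))) (inj₂ (inj₁ (_ , refl)))   = refl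
    functional′ (inj₁ (refl , _))           (inj₂ (inj₂ e))            = ⊥-elim (¬cov-j (_ , e))
    functional′ (inj₂ (inj₁ (refl , _)))    (inj₂ (inj₂ e))            = ⊥-elim (¬cov-i (_ , e))
    functional′ (inj₂ (inj₂ e))             (inj₁ (refl , _))          = ⊥-elim (¬cov-j (_ , e))
    functional′ (inj₂ (inj₂ e))             (inj₂ (inj₁ (refl , _)))   = ⊥-elim (¬cov-i (_ , e))
    functional′ (inj₂ (inj₂ e))             (inj₂ (inj₂ e′))           = functional e e′

  addEdge-¬isMatching : ¬ T (entry M i j) → Covered (entry M) i ⊎ Covered (entry M) j →
                        ¬ IsMatching G (entry (addEdge M i j))
  addEdge-¬isMatching ¬ij (inj₁ (k , ik)) m′ = ¬ij (subst (T ∘ entry M i) (sym j≡k) ik)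
    where
    j≡k : j ≡ k
    j≡k = IsMatching.functional m′ (T-entry-addEdge-ij M i j) (T-entry-addEdge-⊇ M i j ik)
  addEdge-¬isMatching ¬ij (inj₂ (k , jk)) m′ = ¬ij (symmetric (subst (T ∘ entry M j) (sym i≡k) jk))
    where
    i≡k : i ≡ k
    i≡k = IsMatching.functional m′ (T-entry-addEdge-ji M i j) (T-entry-addEdge-⊇ M i j jk)

T-isMaximalMatching⁻ : ∀ {n} {G : Graph n} {M} → T (isMaximalMatching G M) →
                       IsMaximalMatching G (entry M)
T-isMaximalMatching⁻ {G = G} {M} h = record { matching = m ; cover = cover }
  where
  m : IsMatching G (entry M)
  m = T-isMatching⁻ {G = G} {M} (proj₁ (to T-∧ h))

  cover : ∀ {i j} → T (adj G i j) → Covered (entry M) i ⊎ Covered (entry M) j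
  cover {i} {j} ij with covered? (entry M) i | covered? (entry M) j
  ... | yes cov-i | _         = inj₁ cov-i
  ... | no _      | yes cov-j = inj₂ cov-j
  ... | no ¬cov-i | no ¬cov-j =
    ⊥-elim (T-not⁻ (T-⇒ᵇ⁻ maximal (from T-∧ (ij , T-not⁺ λ e → ¬cov-i (j , e))))
                   (T-isMatching⁺ {M = addEdge M i j} (addEdge-isMatching {M = M} m ij ¬cov-i ¬cov-j)))
    where
    maximal : T ((adj G i j ∧ not (entry M i j)) ⇒ᵇ not (isMatching G (addEdge M i j)))
    maximal = T-forallV⁻ (T-forallV⁻ (proj₂ (to T-∧ h)) i) j

T-isMaximalMatching⁺ : ∀ {n} {G : Graph n} {M} → IsMaximalMatching G (entry M) →
                       T (isMaximalMatching G M)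
T-isMaximalMatching⁺ {n} {G} {M} mm = from T-∧ (T-isMatching⁺ {M = M} matching ,
  T-forallV⁺ {p = λ i → forallV (clause i)} λ i → T-forallV⁺ {p = clause i} λ j → T-⇒ᵇ⁺ λ h →
    let (ij , ¬ij) = to T-∧ h in
    T-not⁺ λ m′ → addEdge-¬isMatching {M = M} matching (T-not⁻ ¬ij) (cover ij)
                                      (T-isMatching⁻ {M = addEdge M i j} m′))
  where
  open IsMaximalMatching mm
  clause : Fin n → Fin n → Bool
  clause i j = (adj G i j ∧ not (entry M i j)) ⇒ᵇ not (isMatching G (addEdge M i j))

IsMatching-resp : ∀ {n} {G : Graph n} {E E′} → (∀ a b → E a b ≡ E′ a b) →
                  IsMatching G E → IsMatching G E′
IsMatching-resp {E = E} {E′} E≗E′ m = record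
  { ⊆adj       = ⊆adj ∘ E′⇒E
  ; symmetric  = E⇒E′ ∘ symmetric ∘ E′⇒E
  ; functional = λ e e′ → functional (E′⇒E e) (E′⇒E e′)
  }
  where
  open IsMatching m
  E⇒E′ : ∀ {a b} → T (E a b) → T (E′ a b)
  E⇒E′ {a} {b} = subst T (E≗E′ a b)
  E′⇒E : ∀ {a b} → T (E′ a b) → T (E a b)
  E′⇒E {a} {b} = subst T (sym (E≗E′ a b))

IsMaximalMatching-resp : ∀ {n} {G : Graph n} {E E′} → (∀ a b → E a b ≡ E′ a b) →
                         IsMaximalMatching G E → IsMaximalMatching G E′
IsMaximalMatching-resp {E = E} {E′} E≗E′ mm = record
  { matching = IsMatching-resp E≗E′ matching
  ; cover    = λ ij → Data.Sum.map covered covered (cover ij)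
  }
  where
  open IsMaximalMatching mm
  covered : ∀ {a} → Covered E a → Covered E′ a
  covered (k , e) = k , subst T (E≗E′ _ k) e

-- Counting maximal matchings

private
  head-∈ : ∀ {A : Set} {k} (vs : List (Vec A k)) xs {v : Vec A (suc k)} →
           v ∈ concatMap (λ x → map (x ∷_) vs) xs → Vec.head v ∈ xs
  head-∈ vs (x ∷ xs) v∈ with ∈-++⁻ (map (x ∷_) vs) v∈
  ... | inj₂ v∈′ = there (head-∈ vs xs v∈′)
  ... | inj₁ v∈′ with ∈-map⁻ (x ∷_) v∈′
  ...   | _ , _ , refl = here refl

vecsOf-unique : ∀ {A : Set} {xs : List A} → Unique xs → ∀ k → Unique (vecsOf xs k)
vecsOf-unique u zero    = [] ∷ []
vecsOf-unique {A} {xs} u (suc k) = go xs u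
  where
  vs : List (Vec A k)
  vs = vecsOf xs k
  go : ∀ ys → Unique ys → Unique (concatMap (λ y → map (y ∷_) vs) ys)
  go []       _         = []
  go (y ∷ ys) (y∉ ∷ u′) =
    Unique.++⁺ (Unique.map⁺ Vecₚ.∷-injectiveʳ (vecsOf-unique u k)) (go ys u′) λ (v∈ , v∈′) →
      let (_ , _ , v≡) = ∈-map⁻ (y ∷_) v∈ in All.lookup y∉ (head-∈ vs ys (subst (_∈ _) v≡ v∈′)) refl

∈-vecsOf : ∀ {A : Set} {xs : List A} → (∀ x → x ∈ xs) → ∀ {k} (v : Vec A k) → v ∈ vecsOf xs k
∈-vecsOf all∈ []       = here refl
∈-vecsOf {xs = xs} all∈ {suc k} (x ∷ v) = ∈-concatMap⁺ (λ y → map (y ∷_) (vecsOf xs k))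
  (Any.map (λ { refl → ∈-map⁺ (x ∷_) (∈-vecsOf all∈ v) }) (all∈ x))

allMats-unique : ∀ n → Unique (allMats n)
allMats-unique n = vecsOf-unique (vecsOf-unique (((λ ()) ∷ []) ∷ [] ∷ []) n) n

∈-allMats : ∀ {n} (M : Mat n) → M ∈ allMats n
∈-allMats = ∈-vecsOf (∈-vecsOf λ { true → here refl ; false → there (here refl) })

tabulateMat : ∀ {n} → (Fin n → Fin n → Bool) → Mat n
tabulateMat E = Vec.tabulate λ a → Vec.tabulate (E a)

entry-tabulateMat : ∀ {n} (E : Fin n → Fin n → Bool) a b → entry (tabulateMat E) a b ≡ E a b
entry-tabulateMat E a b =
  trans (cong (λ r → lookup r b) (Vecₚ.lookup∘tabulate _ a)) (Vecₚ.lookup∘tabulate (E a) b)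

Mat-ext : ∀ {n} {M M′ : Mat n} → (∀ a b → entry M a b ≡ entry M′ a b) → M ≡ M′
Mat-ext M≗M′ = lookup-ext λ a → lookup-ext (M≗M′ a)
  where
  lookup-ext : ∀ {A : Set} {k} {xs ys : Vec A k} → (∀ i → lookup xs i ≡ lookup ys i) → xs ≡ ys
  lookup-ext {xs = xs} {ys} xs≗ys =
    trans (sym (Vecₚ.tabulate∘lookup xs)) (trans (Vecₚ.tabulate-cong xs≗ys) (Vecₚ.tabulate∘lookup ys))

maximalMatchings : ∀ {n} → Graph n → List (Mat n)
maximalMatchings {n} G = filterᵇ (isMaximalMatching G) (allMats n)

module _ {n} (G : Graph n) where

  maximalMatchings-unique : Unique (maximalMatchings G)
  maximalMatchings-unique = Unique.filter⁺ (T? ∘ isMaximalMatching G) (allMats-unique n)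

  ∈-maximalMatchings⁺ : ∀ {M} → IsMaximalMatching G (entry M) → M ∈ maximalMatchings G
  ∈-maximalMatchings⁺ {M} mm =
    ∈-filter⁺ (T? ∘ isMaximalMatching G) (∈-allMats M) (T-isMaximalMatching⁺ {M = M} mm)

  ∈-maximalMatchings⁻ : ∀ {M} → M ∈ maximalMatchings G → IsMaximalMatching G (entry M)
  ∈-maximalMatchings⁻ {M} M∈ =
    T-isMaximalMatching⁻ {M = M} (proj₂ (∈-filter⁻ (T? ∘ isMaximalMatching G) {xs = allMats n} M∈))

  module _ {A : Set} (F : A → Mat n) {xs : List A} where

    length≤Ψ : (∀ {x y} → F x ≡ F y → x ≡ y) → Unique xs →
               (∀ {x} → x ∈ xs → IsMaximalMatching G (entry (F x))) → length xs ≤ Ψ G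
    length≤Ψ F-injective xs-unique maximal =
      subst (_≤ Ψ G) (length-map F xs) (Unique⇒length≤ (Unique.map⁺ F-injective xs-unique) λ Fx∈ →
        let (x , x∈ , ≡Fx) = ∈-map⁻ F Fx∈ in
        subst (_∈ maximalMatchings G) (sym ≡Fx) (∈-maximalMatchings⁺ (maximal x∈)))

    Ψ≤length : (∀ {M} → IsMaximalMatching G (entry M) → ∃ λ x → x ∈ xs × M ≡ F x) → Ψ G ≤ length xs
    Ψ≤length onto = subst (Ψ G ≤_) (length-map F xs) (Unique⇒length≤ maximalMatchings-unique λ M∈ →
      let (x , x∈ , M≡Fx) = onto (∈-maximalMatchings⁻ M∈) in
      subst (_∈ map F xs) (sym M≡Fx) (∈-map⁺ F x∈))

-- Invariance under isomorphism

≅-sym : ∀ {n m} {G : Graph n} {H : Graph m} → G ≅ H → H ≅ G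
≅-sym {G = G} {H} G≅H = record
  { bij      = ↔-sym bij
  ; preserve = λ a b →
      trans (cong₂ (adj H) (sym (π∘π⁻¹ a)) (sym (π∘π⁻¹ b))) (sym (preserve (π⁻¹ a) (π⁻¹ b)))
  }
  where
  open _≅_ G≅H
  open Inverse bij renaming (from to π⁻¹; strictlyInverseˡ to π∘π⁻¹)

module _ {n m} {G : Graph n} {H : Graph m} (G≅H : G ≅ H) where
  open _≅_ G≅H
  open Inverse bij renaming (to to π; from to π⁻¹; strictlyInverseˡ to π∘π⁻¹; strictlyInverseʳ to π⁻¹∘π)

  transport-isMaximalMatching : ∀ {E} → IsMaximalMatching G E →
                                IsMaximalMatching H (λ a b → E (π⁻¹ a) (π⁻¹ b))
  transport-isMaximalMatching {E} mm = record
    { matching = record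
      { ⊆adj       = λ {a} {b} e → subst T (adj-π⁻¹ a b) (⊆adj e)
      ; symmetric  = symmetric
      ; functional = λ e e′ → trans (sym (π∘π⁻¹ _)) (trans (cong π (functional e e′)) (π∘π⁻¹ _))
      }
    ; cover = λ {a} {b} ab →
        Data.Sum.map covered-π covered-π (cover (subst T (sym (adj-π⁻¹ a b)) ab))
    }
    where
    open IsMaximalMatching mm
    adj-π⁻¹ : ∀ a b → adj G (π⁻¹ a) (π⁻¹ b) ≡ adj H a b
    adj-π⁻¹ a b = trans (preserve (π⁻¹ a) (π⁻¹ b)) (cong₂ (adj H) (π∘π⁻¹ a) (π∘π⁻¹ b))
    covered-π : ∀ {a} → Covered E (π⁻¹ a) → Covered (λ a b → E (π⁻¹ a) (π⁻¹ b)) a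
    covered-π {a} (k , e) = π k , subst (T ∘ E (π⁻¹ a)) (sym (π⁻¹∘π k)) e

  Ψ-mono-≅ : Ψ G ≤ Ψ H
  Ψ-mono-≅ = length≤Ψ H transportMat transportMat-injective (maximalMatchings-unique G) λ M∈ →
    IsMaximalMatching-resp (λ a b → sym (entry-tabulateMat _ a b))
      (transport-isMaximalMatching (∈-maximalMatchings⁻ G M∈))
    where
    transportMat : Mat n → Mat m
    transportMat M = tabulateMat λ a b → entry M (π⁻¹ a) (π⁻¹ b)

    entry-transportMat : ∀ M a b → entry (transportMat M) (π a) (π b) ≡ entry M a b
    entry-transportMat M a b =
      trans (entry-tabulateMat _ (π a) (π b)) (cong₂ (entry M) (π⁻¹∘π a) (π⁻¹∘π b))

    transportMat-injective : ∀ {M M′} → transportMat M ≡ transportMat M′ → M ≡ M′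
    transportMat-injective {M} {M′} eq = Mat-ext λ a b → begin
      entry M a b                         ≡⟨ entry-transportMat M a b ⟨
      entry (transportMat M) (π a) (π b)  ≡⟨ cong (λ N → entry N (π a) (π b)) eq ⟩
      entry (transportMat M′) (π a) (π b) ≡⟨ entry-transportMat M′ a b ⟩
      entry M′ a b                        ∎
      where open ≡-Reasoning

Ψ-cong-≅ : ∀ {n m} {G : Graph n} {H : Graph m} → G ≅ H → Ψ G ≡ Ψ H
Ψ-cong-≅ G≅H = ≤-antisym (Ψ-mono-≅ G≅H) (Ψ-mono-≅ (≅-sym G≅H))

-- The star S^t(K_{1,m}) on vertex labels, with s = m ∸ t subdivided spokes

SymClosure-functional : ∀ {A : Set} {R : A → A → Set} →
  (∀ {a b c} → R a b → R a c → b ≡ c) → (∀ {a b c} → R b a → R c a → b ≡ c) →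
  (∀ {a b c} → R a b → R c a → ⊥) →
  ∀ {a b c} → SymClosure R a b → SymClosure R a c → b ≡ c
SymClosure-functional functional injective disjoint = λ where
  (fwd ab) (fwd ac) → functional ab ac
  (bwd ba) (bwd ca) → injective ba ca
  (fwd ab) (bwd ca) → ⊥-elim (disjoint ab ca)
  (bwd ba) (fwd ac) → ⊥-elim (disjoint ac ba)

data Arc (m s a b : ℕ) : Set where
  spoke   : a ≡ 0 → 1 ≤ b → b ≤ m → Arc m s a b
  pendant : 1 ≤ a → a ≤ s → b ≡ m + a → Arc m s a b

Adj : ℕ → ℕ → ℕ → ℕ → Set
Adj m s = SymClosure (Arc m s)

private
  pendant≰ : ∀ {m i b} → 1 ≤ i → b ≡ m + i → b ≰ m
  pendant≰ {m} 1≤i refl = <⇒≱ (m<m+n m 1≤i)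

module _ {m t : ℕ} where

  T-starArc⁻ : ∀ {a b} → T (starArc m t a b) → Arc m (m ∸ t) a b
  T-starArc⁻ {a} {b} h with to T-∨ h
  ... | inj₁ h₁ = let (a≡0 , 1≤b , b≤m) = T-∧³ h₁ in
    spoke (≡ᵇ⇒≡ a 0 a≡0) (≤ᵇ⇒≤ 1 b 1≤b) (≤ᵇ⇒≤ b m b≤m)
  ... | inj₂ h₂ = let (1≤a , a≤s , b≡) = T-∧³ h₂ in
    pendant (≤ᵇ⇒≤ 1 a 1≤a) (≤ᵇ⇒≤ a (m ∸ t) a≤s) (≡ᵇ⇒≡ b (m + a) b≡)

  T-starArc⁺ : ∀ {a b} → Arc m (m ∸ t) a b → T (starArc m t a b)
  T-starArc⁺ {a} {b} (spoke a≡0 1≤b b≤m) =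
    from T-∨ (inj₁ (from T-∧ (≡⇒≡ᵇ a 0 a≡0 , from T-∧ (≤⇒≤ᵇ 1≤b , ≤⇒≤ᵇ b≤m))))
  T-starArc⁺ {a} {b} (pendant 1≤a a≤s b≡) =
    from T-∨ (inj₂ (from T-∧ (≤⇒≤ᵇ 1≤a , from T-∧ (≤⇒≤ᵇ a≤s , ≡⇒≡ᵇ b (m + a) b≡))))

  Arc-irreflexive : ∀ {a b} → Arc m (m ∸ t) a b → a ≢ b
  Arc-irreflexive (spoke a≡0 1≤b _)    a≡b = n>0⇒n≢0 1≤b (trans (sym a≡b) a≡0)
  Arc-irreflexive (pendant 1≤a a≤s b≡) a≡b =
    pendant≰ 1≤a b≡ (subst (_≤ m) a≡b (≤-trans a≤s (m∸n≤m m t)))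

  T-starAdj⁻ : ∀ {a b} → T (starAdjℕ m t a b) → Adj m (m ∸ t) a b
  T-starAdj⁻ {a} {b} h with to (T-∨ {starArc m t a b}) (proj₂ (to T-∧ h))
  ... | inj₁ ab = fwd (T-starArc⁻ ab)
  ... | inj₂ ba = bwd (T-starArc⁻ ba)

  T-starAdj⁺ : ∀ {a b} → Adj m (m ∸ t) a b → T (starAdjℕ m t a b)
  T-starAdj⁺ {a} {b} ab = from T-∧ (T-not⁺ (a≢b ab ∘ ≡ᵇ⇒≡ a b) , from T-∨ (arcs ab))
    where
    a≢b : Adj m (m ∸ t) a b → a ≢ b
    a≢b (fwd arc) a≡b = Arc-irreflexive arc a≡b
    a≢b (bwd arc) a≡b = Arc-irreflexive arc (sym a≡b)
    arcs : Adj m (m ∸ t) a b → T (starArc m t a b) ⊎ T (starArc m t b a)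
    arcs (fwd arc) = inj₁ (T-starArc⁺ arc)
    arcs (bwd arc) = inj₂ (T-starArc⁺ arc)

module _ {m s : ℕ} where

  Adj-centre : ∀ {x} → Adj m s 0 x → 1 ≤ x × x ≤ m
  Adj-centre (fwd (spoke _ 1≤x x≤m))  = 1≤x , x≤m
  Adj-centre (fwd (pendant () _ _))
  Adj-centre (bwd (spoke _ () _))
  Adj-centre (bwd (pendant 1≤x _ 0≡)) = ⊥-elim (pendant≰ 1≤x 0≡ z≤n)

  Adj-inner : ∀ {i x} → 1 ≤ i → i ≤ m → Adj m s i x → x ≡ 0 ⊎ (i ≤ s × x ≡ m + i)
  Adj-inner 1≤i _   (fwd (spoke i≡0 _ _))    = ⊥-elim (n>0⇒n≢0 1≤i i≡0)
  Adj-inner _   _   (fwd (pendant _ i≤s x≡)) = inj₂ (i≤s , x≡)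
  Adj-inner _   _   (bwd (spoke x≡0 _ _))    = inj₁ x≡0
  Adj-inner _   i≤m (bwd (pendant 1≤x _ i≡)) = ⊥-elim (pendant≰ 1≤x i≡ i≤m)

  Adj-outer : ∀ {i x} → s ≤ m → 1 ≤ i → Adj m s (m + i) x → x ≡ i
  Adj-outer _   1≤i (fwd (spoke m+i≡0 _ _))   = ⊥-elim (pendant≰ 1≤i (sym m+i≡0) z≤n)
  Adj-outer s≤m 1≤i (fwd (pendant _ m+i≤s _)) = ⊥-elim (pendant≰ 1≤i refl (≤-trans m+i≤s s≤m))
  Adj-outer _   1≤i (bwd (spoke _ _ m+i≤m))   = ⊥-elim (pendant≰ 1≤i refl m+i≤m)
  Adj-outer _   _   (bwd (pendant _ _ m+i≡))  = sym (+-cancelˡ-≡ m _ _ m+i≡)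

  Adj-bounded : ∀ {a b} → s ≤ m → Adj m s a b → b ≤ m + s
  Adj-bounded _   (fwd (spoke _ _ b≤m))      = ≤-trans b≤m (m≤m+n m s)
  Adj-bounded _   (fwd (pendant _ a≤s refl)) = +-monoʳ-≤ m a≤s
  Adj-bounded _   (bwd (spoke refl _ _))     = z≤n
  Adj-bounded s≤m (bwd (pendant _ b≤s _))    = ≤-trans (≤-trans b≤s s≤m) (m≤m+n m s)

-- The maximal matching in which the centre takes the neighbour j (no neighbour if j = 0) and
-- every other subdivided neighbour i takes its pendant vertex m + i.
data MatchArc (m s j a b : ℕ) : Set where
  spoke   : a ≡ 0 → b ≡ j → 1 ≤ j → j ≤ m → MatchArc m s j a b
  pendant : 1 ≤ a → a ≤ s → a ≢ j → b ≡ m + a → MatchArc m s j a b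

MatchEdge : ℕ → ℕ → ℕ → ℕ → ℕ → Set
MatchEdge m s j = SymClosure (MatchArc m s j)

module _ {m s j : ℕ} where

  MatchArc⇒Arc : ∀ {a b} → MatchArc m s j a b → Arc m s a b
  MatchArc⇒Arc (spoke a≡0 refl 1≤j j≤m) = spoke a≡0 1≤j j≤m
  MatchArc⇒Arc (pendant 1≤a a≤s _ b≡)   = pendant 1≤a a≤s b≡

  MatchEdge-functional : s ≤ m → ∀ {a b c} → MatchEdge m s j a b → MatchEdge m s j a c → b ≡ c
  MatchEdge-functional s≤m = SymClosure-functional functional injective disjoint
    where
    functional : ∀ {a b c} → MatchArc m s j a b → MatchArc m s j a c → b ≡ c
    functional (spoke _ refl _ _)   (spoke _ refl _ _)   = refl
    functional (pendant _ _ _ refl) (pendant _ _ _ refl) = refl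
    functional (spoke a≡0 _ _ _)    (pendant 1≤a _ _ _)  = ⊥-elim (n>0⇒n≢0 1≤a a≡0)
    functional (pendant 1≤a _ _ _)  (spoke a≡0 _ _ _)    = ⊥-elim (n>0⇒n≢0 1≤a a≡0)

    injective : ∀ {a b c} → MatchArc m s j b a → MatchArc m s j c a → b ≡ c
    injective (spoke refl _ _ _)   (spoke refl _ _ _)   = refl
    injective (pendant _ _ _ a≡)   (pendant _ _ _ a≡′)  = +-cancelˡ-≡ m _ _ (trans (sym a≡) a≡′)
    injective (spoke _ refl _ a≤m) (pendant 1≤c _ _ a≡) = ⊥-elim (pendant≰ 1≤c a≡ a≤m)
    injective (pendant 1≤b _ _ a≡) (spoke _ refl _ a≤m) = ⊥-elim (pendant≰ 1≤b a≡ a≤m)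

    disjoint : ∀ {a b c} → MatchArc m s j a b → MatchArc m s j c a → ⊥
    disjoint (spoke a≡0 _ _ _)   (spoke _ a≡j 1≤j _)  = n>0⇒n≢0 1≤j (trans (sym a≡j) a≡0)
    disjoint (spoke refl _ _ _)  (pendant 1≤c _ _ 0≡) = pendant≰ 1≤c 0≡ z≤n
    disjoint (pendant _ _ a≢j _) (spoke _ a≡j _ _)    = a≢j a≡j
    disjoint (pendant _ a≤s _ _) (pendant 1≤c _ _ a≡) = pendant≰ 1≤c a≡ (≤-trans a≤s s≤m)

  MatchEdge-centre : ∀ {b} → MatchEdge m s j 0 b → 1 ≤ j × b ≡ j
  MatchEdge-centre (fwd (spoke _ b≡j 1≤j _))   = 1≤j , b≡j
  MatchEdge-centre (fwd (pendant () _ _ _))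
  MatchEdge-centre (bwd (spoke _ 0≡j 1≤j _))   = ⊥-elim (n>0⇒n≢0 1≤j (sym 0≡j))
  MatchEdge-centre (bwd (pendant 1≤b _ _ 0≡)) = ⊥-elim (pendant≰ 1≤b 0≡ z≤n)

matchArcᵇ : (m t j a b : ℕ) → Bool
matchArcᵇ m t j a b = starArc m t a b ∧ (if a ≡ᵇ 0 then b ≡ᵇ j else not (a ≡ᵇ j))

matchEdgeᵇ : (m t j a b : ℕ) → Bool
matchEdgeᵇ m t j a b = matchArcᵇ m t j a b ∨ matchArcᵇ m t j b a

module _ {m t j : ℕ} where

  private
    kept⇒MatchArc : ∀ {a b} → Arc m (m ∸ t) a b →
                    T (if a ≡ᵇ 0 then b ≡ᵇ j else not (a ≡ᵇ j)) → MatchArc m (m ∸ t) j a b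
    kept⇒MatchArc {b = b} (spoke refl 1≤b b≤m) b≡ᵇj with ≡ᵇ⇒≡ b j b≡ᵇj
    ... | refl = spoke refl refl 1≤b b≤m
    kept⇒MatchArc {suc a} (pendant 1≤a a≤s b≡) a≢ᵇj =
      pendant 1≤a a≤s (T-not⁻ a≢ᵇj ∘ ≡⇒≡ᵇ (suc a) j) b≡
    kept⇒MatchArc {zero} (pendant () _ _) _

  T-matchArc⁻ : ∀ {a b} → T (matchArcᵇ m t j a b) → MatchArc m (m ∸ t) j a b
  T-matchArc⁻ h = let (arc , kept) = to T-∧ h in kept⇒MatchArc (T-starArc⁻ {t = t} arc) kept

  T-matchArc⁺ : ∀ {a b} → MatchArc m (m ∸ t) j a b → T (matchArcᵇ m t j a b)
  T-matchArc⁺ arc@(spoke refl refl _ _) =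
    from T-∧ (T-starArc⁺ {t = t} (MatchArc⇒Arc arc) , ≡⇒≡ᵇ j j refl)
  T-matchArc⁺ {suc a} arc@(pendant _ _ a≢j _) =
    from T-∧ (T-starArc⁺ {t = t} (MatchArc⇒Arc arc) , T-not⁺ (a≢j ∘ ≡ᵇ⇒≡ (suc a) j))
  T-matchArc⁺ {zero} (pendant () _ _ _)

  T-matchEdge⁻ : ∀ {a b} → T (matchEdgeᵇ m t j a b) → MatchEdge m (m ∸ t) j a b
  T-matchEdge⁻ {a} {b} h with to (T-∨ {matchArcᵇ m t j a b}) h
  ... | inj₁ ab = fwd (T-matchArc⁻ ab)
  ... | inj₂ ba = bwd (T-matchArc⁻ ba)

  T-matchEdge⁺ : ∀ {a b} → MatchEdge m (m ∸ t) j a b → T (matchEdgeᵇ m t j a b)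
  T-matchEdge⁺ (fwd ab) = from T-∨ (inj₁ (T-matchArc⁺ ab))
  T-matchEdge⁺ (bwd ba) = from T-∨ (inj₂ (T-matchArc⁺ ba))

  Adj-covered : (j ≡ 0 → t ≡ 0) → j ≤ m → ∀ {a b} → Adj m (m ∸ t) a b →
                (∃ λ c → MatchEdge m (m ∸ t) j a c) ⊎ (∃ λ c → MatchEdge m (m ∸ t) j b c)
  Adj-covered admissible j≤m (fwd arc) = Arc-covered arc
    where
    Arc-covered : ∀ {a b} → Arc m (m ∸ t) a b →
                  (∃ λ c → MatchEdge m (m ∸ t) j a c) ⊎ (∃ λ c → MatchEdge m (m ∸ t) j b c)
    Arc-covered {b = b} (spoke a≡0 1≤b b≤m) with j ≟ℕ 0
    ... | yes j≡0 = inj₂ (m + b , fwd (pendant 1≤b b≤s b≢j refl))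
      where
      b≤s : b ≤ m ∸ t
      b≤s = subst (λ t → b ≤ m ∸ t) (sym (admissible j≡0)) b≤m
      b≢j : b ≢ j
      b≢j b≡j = n>0⇒n≢0 1≤b (trans b≡j j≡0)
    ... | no  j≢0 = inj₁ (j , fwd (spoke a≡0 refl (n≢0⇒n>0 j≢0) j≤m))
    Arc-covered {a} (pendant 1≤a a≤s b≡) with a ≟ℕ j
    ... | yes a≡j = inj₁ (0 , bwd (spoke refl a≡j (subst (1 ≤_) a≡j 1≤a) j≤m))
    ... | no  a≢j = inj₁ (_ , fwd (pendant 1≤a a≤s a≢j b≡))
  Adj-covered admissible j≤m (bwd arc) = Data.Sum.swap (Adj-covered admissible j≤m (fwd arc))

-- The maximal matchings of S^t(K_{1,m})

module Star {t m : ℕ} (t≤m : t ≤ m) where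

  private
    s : ℕ
    s = m ∸ t

    s≤m : s ≤ m
    s≤m = m∸n≤m m t

    N : ℕ
    N = 2 * m ∸ t + 1

    G : Graph N
    G = S t m

    m+s<N : m + s < N
    m+s<N = subst (λ n → m + s < n + 1) m+s≡2m∸t (m<m+n (m + s) z<s)
      where
      m+s≡2m∸t : m + s ≡ 2 * m ∸ t
      m+s≡2m∸t = trans (sym (+-∸-assoc m t≤m)) (cong (λ k → m + k ∸ t) (sym (+-identityʳ m)))

  vertex : ∀ ℓ → ℓ ≤ m + s → Fin N
  vertex ℓ ℓ≤ = fromℕ< (≤-<-trans ℓ≤ m+s<N)

  toℕ-vertex : ∀ {ℓ} (ℓ≤ : ℓ ≤ m + s) → toℕ (vertex ℓ ℓ≤) ≡ ℓ
  toℕ-vertex ℓ≤ = toℕ-fromℕ< (≤-<-trans ℓ≤ m+s<N)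

  centre : Fin N
  centre = vertex 0 z≤n

  label≡0⇒centre : ∀ {a} → toℕ a ≡ 0 → a ≡ centre
  label≡0⇒centre a≡0 = toℕ-injective (trans a≡0 (sym (toℕ-vertex z≤n)))

  private
    leaf : Fin N
    leaf = vertex m (m≤m+n m s)

    toℕ-leaf : toℕ leaf ≡ m
    toℕ-leaf = toℕ-vertex (m≤m+n m s)

    1≤leaf : 1 ≤ m → 1 ≤ toℕ leaf
    1≤leaf = subst (1 ≤_) (sym toℕ-leaf)

    leaf≤m : toℕ leaf ≤ m
    leaf≤m = subst (_≤ m) (sym toℕ-leaf) ≤-refl

  T-adj⁻ : ∀ {a b} → T (adj G a b) → Adj m s (toℕ a) (toℕ b)
  T-adj⁻ = T-starAdj⁻ {m} {t}

  T-adj⁺ : ∀ {a b} → Adj m s (toℕ a) (toℕ b) → T (adj G a b)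
  T-adj⁺ = T-starAdj⁺ {m} {t}

  starMatching : Fin (suc m) → Fin N → Fin N → Bool
  starMatching j a b = matchEdgeᵇ m t (toℕ j) (toℕ a) (toℕ b)

  Admissible : Fin (suc m) → Set
  Admissible j = toℕ j ≡ 0 → t ≡ 0

  module _ {j : Fin (suc m)} where

    T-starMatching⁻ : ∀ {a b} → T (starMatching j a b) → MatchEdge m s (toℕ j) (toℕ a) (toℕ b)
    T-starMatching⁻ = T-matchEdge⁻ {m} {t} {toℕ j}

    T-starMatching⁺ : ∀ {a b} → MatchEdge m s (toℕ j) (toℕ a) (toℕ b) → T (starMatching j a b)
    T-starMatching⁺ = T-matchEdge⁺ {m} {t} {toℕ j}

    starMatching-maximal : Admissible j → IsMaximalMatching G (starMatching j)
    starMatching-maximal admissible = record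
      { matching = record
        { ⊆adj       = λ {a} {b} e → T-adj⁺ {a} {b} (Sym.map MatchArc⇒Arc (T-starMatching⁻ e))
        ; symmetric  = λ {a} {b} e → T-starMatching⁺ {b} {a} (Sym.symmetric _ (T-starMatching⁻ e))
        ; functional = λ {a} {b} {c} e e′ → toℕ-injective
            (MatchEdge-functional s≤m (T-starMatching⁻ {a} {b} e) (T-starMatching⁻ {a} {c} e′))
        }
      ; cover = λ {a} {b} ab →
          Data.Sum.map covered covered (Adj-covered admissible (toℕ≤pred[n] j) (T-adj⁻ {a} {b} ab))
      }
      where
      covered : ∀ {a} → ∃ (MatchEdge m s (toℕ j) (toℕ a)) → Covered (starMatching j) a
      covered {a} (c , e) = vertex c c≤ ,
        T-starMatching⁺ {a} (subst (MatchEdge m s (toℕ j) (toℕ a)) (sym (toℕ-vertex c≤)) e)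
        where
        c≤ : c ≤ m + s
        c≤ = Adj-bounded s≤m (Sym.map MatchArc⇒Arc e)

  module _ {E : Fin N → Fin N → Bool} (mm : IsMaximalMatching G E) where
    open IsMaximalMatching mm

    private
      adj-labels : ∀ {a b} → T (E a b) → Adj m s (toℕ a) (toℕ b)
      adj-labels {a} {b} e = T-adj⁻ {a} {b} (⊆adj e)

    module _ {j : Fin (suc m)} (centre-spec : ∀ w → T (E centre w) ⇔ (1 ≤ toℕ j × toℕ w ≡ toℕ j)) where

      private
        E⇒MatchArc : ∀ {a b} → Arc m s (toℕ a) (toℕ b) → T (E a b) →
                     MatchArc m s (toℕ j) (toℕ a) (toℕ b)
        E⇒MatchArc {a} {b} (spoke a≡0 _ _) e =
          let (1≤j , b≡j) = to (centre-spec b) (subst (λ x → T (E x b)) (label≡0⇒centre a≡0) e) in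
          spoke a≡0 b≡j 1≤j (toℕ≤pred[n] j)
        E⇒MatchArc {a} {b} (pendant 1≤a a≤s b≡) e = pendant 1≤a a≤s a≢j b≡
          where
          -- otherwise a would be matched both to the centre and to its pendant vertex b
          a≢j : toℕ a ≢ toℕ j
          a≢j a≡j = pendant≰ 1≤a b≡ (subst (_≤ m) (sym b≡0) z≤n)
            where
            centre≡b : centre ≡ b
            centre≡b = functional (symmetric (from (centre-spec a) (subst (1 ≤_) a≡j 1≤a , a≡j))) e
            b≡0 : toℕ b ≡ 0
            b≡0 = trans (cong toℕ (sym centre≡b)) (toℕ-vertex z≤n)

        MatchArc⇒E : ∀ {a b} → MatchArc m s (toℕ j) (toℕ a) (toℕ b) → T (E a b)
        MatchArc⇒E {a} {b} (spoke a≡0 b≡j 1≤j _) =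
          subst (λ x → T (E x b)) (sym (label≡0⇒centre a≡0)) (from (centre-spec b) (1≤j , b≡j))
        MatchArc⇒E {a} {b} arc@(pendant 1≤a a≤s a≢j b≡)
          with cover (T-adj⁺ {a} {b} (fwd (MatchArc⇒Arc arc)))
        ... | inj₁ (w , aw) with Adj-inner 1≤a (≤-trans a≤s s≤m) (adj-labels aw)
        ...   | inj₁ w≡0 = ⊥-elim (a≢j (proj₂ (to (centre-spec a)
                             (symmetric (subst (T ∘ E a) (label≡0⇒centre w≡0) aw)))))
        ...   | inj₂ (_ , w≡) = subst (T ∘ E a) (toℕ-injective (trans w≡ (sym b≡))) aw
        MatchArc⇒E {a} {b} (pendant 1≤a _ _ b≡) | inj₂ (w , bw) = symmetric (subst (T ∘ E b) w≡a bw)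
          where
          w≡a : w ≡ a
          w≡a = toℕ-injective (Adj-outer s≤m 1≤a (subst (λ x → Adj m s x (toℕ w)) b≡ (adj-labels bw)))

      E≗starMatching : ∀ a b → E a b ≡ starMatching j a b
      E≗starMatching a b = T-ext
        (λ e → T-starMatching⁺ {j} {a} {b} (case adj-labels e of λ where
          (fwd arc) → fwd (E⇒MatchArc arc e)
          (bwd arc) → bwd (E⇒MatchArc arc (symmetric e))))
        (λ e → case T-starMatching⁻ {j} {a} {b} e of λ where
          (fwd arc) → MatchArc⇒E arc
          (bwd arc) → symmetric (MatchArc⇒E arc))

    private
      -- the edge from the centre to its neighbour m must be covered at m, by a pendant edge
      unmatched-centre⇒m≤s : ¬ Covered E centre → m ≤ s
      unmatched-centre⇒m≤s ¬cov with m ≟ℕ 0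
      ... | yes m≡0 = subst (_≤ s) (sym m≡0) z≤n
      ... | no  m≢0 = leaf-matched (n≢0⇒n>0 m≢0)
        where
        leaf-matched : 1 ≤ m → m ≤ s
        leaf-matched 1≤m
          with cover (T-adj⁺ {centre} {leaf} (fwd (spoke (toℕ-vertex z≤n) (1≤leaf 1≤m) leaf≤m)))
        ... | inj₁ cov     = ⊥-elim (¬cov cov)
        ... | inj₂ (w , e) with Adj-inner (1≤leaf 1≤m) leaf≤m (adj-labels e)
        ...   | inj₁ w≡0 = ⊥-elim (¬cov (leaf , symmetric (subst (T ∘ E leaf) (label≡0⇒centre w≡0) e)))
        ...   | inj₂ (leaf≤s , _) = subst (_≤ s) toℕ-leaf leaf≤s

      matched-centre : ∀ {w} → T (E centre w) →
                       ∃ λ j → Admissible j × ∀ a b → E a b ≡ starMatching j a b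
      matched-centre {w} e =
        j , (λ j≡0 → ⊥-elim (n>0⇒n≢0 1≤w (trans (sym toℕj) j≡0))) , E≗starMatching λ w′ → mk⇔
          (λ e′ → subst (1 ≤_) (sym toℕj) 1≤w , trans (cong toℕ (functional e′ e)) (sym toℕj))
          (λ (_ , w′≡j) → subst (T ∘ E centre) (toℕ-injective (trans (sym toℕj) (sym w′≡j))) e)
        where
        w-bounds : 1 ≤ toℕ w × toℕ w ≤ m
        w-bounds = Adj-centre (subst (λ x → Adj m s x (toℕ w)) (toℕ-vertex z≤n) (adj-labels e))
        1≤w : 1 ≤ toℕ w
        1≤w = proj₁ w-bounds
        j : Fin (suc m)
        j = fromℕ< (s≤s (proj₂ w-bounds))
        toℕj : toℕ j ≡ toℕ w
        toℕj = toℕ-fromℕ< (s≤s (proj₂ w-bounds))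

    starMatching-complete : ∃ λ j → Admissible j × ∀ a b → E a b ≡ starMatching j a b
    starMatching-complete with any? (λ w → T? (E centre w))
    ... | yes (w , e) = matched-centre e
    ... | no ¬cov =
      Fin.zero , admissible , E≗starMatching λ w → mk⇔ (λ e → ⊥-elim (¬cov (w , e))) λ ()
      where
      admissible : Admissible Fin.zero
      admissible _ = begin
        t      ≡⟨ m∸[m∸n]≡n t≤m ⟨
        m ∸ s  ≡⟨ cong (m ∸_) (≤-antisym s≤m (unmatched-centre⇒m≤s ¬cov)) ⟩
        m ∸ m  ≡⟨ n∸n≡0 m ⟩
        0      ∎
        where open ≡-Reasoning

  starMatrix : Fin (suc m) → Mat N
  starMatrix j = tabulateMat (starMatching j)

  private
    starMatching-centre : ∀ {j w} → T (starMatching j centre w) → toℕ w ≡ toℕ j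
    starMatching-centre {j} {w} e = proj₂ (MatchEdge-centre (subst (λ x → MatchEdge m s (toℕ j) x (toℕ w))
      (toℕ-vertex z≤n) (T-starMatching⁻ {j} {centre} {w} e)))

    centre-partner : ∀ {j j′} → (∀ w → T (starMatching j centre w) → T (starMatching j′ centre w)) →
                     1 ≤ toℕ j → toℕ j ≡ toℕ j′
    centre-partner {j} {j′} ⊆ 1≤j = trans (sym (toℕ-vertex j≤)) (starMatching-centre {j′} (⊆ w centre-j))
      where
      j≤ : toℕ j ≤ m + s
      j≤ = ≤-trans (toℕ≤pred[n] j) (m≤m+n m s)
      w : Fin N
      w = vertex (toℕ j) j≤
      centre-j : T (starMatching j centre w)
      centre-j = T-starMatching⁺ {j} {centre} {w}
        (fwd (spoke (toℕ-vertex z≤n) (toℕ-vertex j≤) 1≤j (toℕ≤pred[n] j)))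

    starMatrix-≡⇒≗ : ∀ {j j′} → starMatrix j ≡ starMatrix j′ →
                     ∀ a b → starMatching j a b ≡ starMatching j′ a b
    starMatrix-≡⇒≗ {j} {j′} eq a b = begin
      starMatching j a b         ≡⟨ entry-tabulateMat (starMatching j) a b ⟨
      entry (starMatrix j) a b   ≡⟨ cong (λ M → entry M a b) eq ⟩
      entry (starMatrix j′) a b  ≡⟨ entry-tabulateMat (starMatching j′) a b ⟩
      starMatching j′ a b        ∎
      where open ≡-Reasoning

  starMatrix-injective : ∀ {j j′} → starMatrix j ≡ starMatrix j′ → j ≡ j′
  starMatrix-injective {Fin.zero}  {Fin.zero}  _  = refl
  starMatrix-injective {Fin.suc _}             eq =
    toℕ-injective (centre-partner (λ w → subst T (starMatrix-≡⇒≗ eq centre w)) (s≤s z≤n))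
  starMatrix-injective {Fin.zero}  {Fin.suc _} eq =
    toℕ-injective (sym (centre-partner (λ w → subst T (sym (starMatrix-≡⇒≗ eq centre w))) (s≤s z≤n)))

  Ψ≡length : (js : List (Fin (suc m))) → Unique js →
             (∀ {j} → j ∈ js → Admissible j) → (∀ {j} → Admissible j → j ∈ js) → Ψ G ≡ length js
  Ψ≡length js unique admissible complete = ≤-antisym
    (Ψ≤length G starMatrix λ mm →
      let (j , adm , E≗) = starMatching-complete mm in
      j , complete adm , Mat-ext λ a b → trans (E≗ a b) (sym (entry-tabulateMat (starMatching j) a b)))
    (length≤Ψ G starMatrix starMatrix-injective unique λ {j} j∈ →
      IsMaximalMatching-resp (λ a b → sym (entry-tabulateMat (starMatching j) a b))
        (starMatching-maximal (admissible j∈)))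

Ψ-S-zero : ∀ m → Ψ (S 0 m) ≡ suc m
Ψ-S-zero m = trans
  (Star.Ψ≡length z≤n (allFin (suc m)) (Unique.allFin⁺ (suc m)) (λ _ _ → refl) (λ _ → ∈-allFin _))
  (length-tabulate id)

Ψ-S-suc : ∀ {t m} → suc t ≤ m → Ψ (S (suc t) m) ≡ m
Ψ-S-suc {t} {m} t<m = trans
  (Star.Ψ≡length t<m (map Fin.suc (allFin m)) (Unique.map⁺ suc-injective (Unique.allFin⁺ m))
                 admissible complete)
  (trans (length-map Fin.suc (allFin m)) (length-tabulate id))
  where
  admissible : ∀ {j} → j ∈ map Fin.suc (allFin m) → Star.Admissible t<m j
  admissible j∈ with ∈-map⁻ Fin.suc j∈
  ... | _ , _ , refl = λ ()
  complete : ∀ {j} → Star.Admissible t<m j → j ∈ map Fin.suc (allFin m)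
  complete {Fin.zero}  adm = case adm refl of λ ()
  complete {Fin.suc i} _   = ∈-map⁺ Fin.suc (∈-allFin i)

⌈2k/2⌉≡k : ∀ k → ⌈ 2 * k /2⌉ ≡ k
⌈2k/2⌉≡k k = trans (cong (λ n → ⌈ k + n /2⌉) (+-identityʳ k)) (sym (n≡⌈n+n/2⌉ k))

⌈2k+1/2⌉≡1+k : ∀ k → ⌈ 2 * k + 1 /2⌉ ≡ suc k
⌈2k+1/2⌉≡1+k k = begin
  ⌈ 2 * k + 1 /2⌉    ≡⟨ cong ⌈_/2⌉ (+-comm (2 * k) 1) ⟩
  ⌈ suc (2 * k) /2⌉  ≡⟨ cong (λ n → ⌈ suc (k + n) /2⌉) (+-identityʳ k) ⟩
  suc ⌊ k + k /2⌋    ≡⟨ cong suc (n≡⌊n+n/2⌋ k) ⟨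
  suc k              ∎
  where open ≡-Reasoning

lemma2p5 : (n : ℕ) (T : Graph n) →
    (Σ ℕ (λ k → n ≡ 2 * k + 1 ×
        ((0 ≤ k × T ≅ S 0 k) ⊎ (2 ≤ suc k × T ≅ S 2 (suc k)))))
    ⊎ (Σ ℕ (λ k → n ≡ 2 * k × 1 ≤ k × T ≅ S 1 k)) →
    Ψ T ≡ ⌈ n /2⌉
lemma2p5 n T (inj₁ (k , refl , inj₁ (_ , T≅S))) =
  trans (Ψ-cong-≅ T≅S) (trans (Ψ-S-zero k) (sym (⌈2k+1/2⌉≡1+k k)))
lemma2p5 n T (inj₁ (k , refl , inj₂ (2≤1+k , T≅S))) =
  trans (Ψ-cong-≅ T≅S) (trans (Ψ-S-suc 2≤1+k) (sym (⌈2k+1/2⌉≡1+k k)))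
lemma2p5 n T (inj₂ (k , refl , 1≤k , T≅S)) =
  trans (Ψ-cong-≅ T≅S) (trans (Ψ-S-suc 1≤k) (sym (⌈2k/2⌉≡k k)))
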